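{- Let $k\in\mathbb N$ and let $G$ be a graph containing a $k$-clique-matching structure. Then $G$ has a $k$-edge induced subgraph.
   Context: Graphs are simple, finite, with nonempty vertex set. A $k$-edge induced subgraph of $G$ is $G[S]$ for some nonempty $S\subseteq V(G)$ with exactly $k$ edges. $G=(V,E)$ contains a $k$-clique-matching structure on pairwise distinct vertices $u_1,\dots,u_k,v_1,\dots,v_k$ if (CM1) for all $i,j\in[k]$, $\{u_i,v_j\}\in E$ iff $i=j$, and (CM2) $\{u_1,\dots,u_k\}$ is a clique in $G$. -}

module Defs where

open import Data.Nat using (ℕ; suc; _<_)
open import Data.Bool using (Bool; true; false; _∧_)
open import Data.Fin using (Fin; toℕ)
open import Data.Fin.Subset using (Subset; _∈_)
open import Data.Vec using (lookup)
open import Data.List using (List; length; filterᵇ; allFin; concatMap; map)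
open import Data.Product using (_×_; _,_; ∃)
open import Relation.Binary.PropositionalEquality using (_≡_)
open import Relation.Nullary using (¬_)

record Graph (n : ℕ) : Set where
  field
    adj   : Fin n → Fin n → Bool
    sym   : ∀ x y → adj x y ≡ adj y x
    irrefl : ∀ x → adj x x ≡ false
open Graph public

allPairs : (n : ℕ) → List (Fin n × Fin n)
allPairs n = concatMap (λ i → map (λ j → (i , j)) (allFin n)) (allFin n)

_<ᵇF_ : ∀ {n} → Fin n → Fin n → Bool
i <ᵇF j = Data.Nat._<ᵇ_ (toℕ i) (toℕ j)

inducedEdges : ∀ {n} → Graph n → Subset n → ℕ
inducedEdges {n} G S =
  length (filterᵇ (λ { (i , j) → (i <ᵇF j) ∧ (lookup S i ∧ (lookup S j ∧ adj G i j)) })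
                  (allPairs n))

HasKEdgeInducedSubgraph : ∀ {n} → Graph n → ℕ → Set
HasKEdgeInducedSubgraph {n} G k =
  ∃ λ (S : Subset n) → (∃ λ x → x ∈ S) × inducedEdges G S ≡ k

record CliqueMatching {n} (G : Graph n) (k : ℕ) : Set where
  field
    u v    : Fin k → Fin n
    u-inj  : ∀ i j → u i ≡ u j → i ≡ j
    v-inj  : ∀ i j → v i ≡ v j → i ≡ j
    uv-dis : ∀ i j → ¬ (u i ≡ v j)
    cm1    : ∀ i j → (adj G (u i) (v j) ≡ true → i ≡ j) × (i ≡ j → adj G (u i) (v j) ≡ true)
    cm2    : ∀ i j → ¬ (i ≡ j) → adj G (u i) (u j) ≡ true

-- Write k = C(a,2) + r with 1 ≤ r ≤ a and let g(t) be the number of edges among v₁,…,v_t.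
-- As v_{t+1} has at most t neighbours among v₁,…,v_t, g(t+1) ≤ g(t) + t, so the least t with
-- r ≤ g(t) + t satisfies g(t) < r ≤ g(t) + t, and m = r − g(t) lies in [1, t]. Take v₁,…,v_t
-- together with a of the u's, m of them of index ≤ t and a − m of index > t (there is room, since
-- t ≤ r and a − m ≤ C(a,2)). The u's span C(a,2) edges, the v's span g(t), and by (CM1) exactly
-- m edges join the two groups: k edges in all.

module Submission where

open import Defs renaming (sym to adj-sym)
open import Data.Bool using (Bool; true; false; _∧_; _∨_)
open import Data.Bool.Properties using (¬-not)
open import Data.Fin using (Fin; zero; suc; toℕ)
open import Data.Fin.Properties using (_≟_; <-cmp)
import Data.Fin.Subset as Subset
open import Data.List using (List; []; _∷_; _++_; map; length; filterᵇ; concatMap; tabulate; allFin; take; drop)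
open import Data.List.Properties
  using (map-∘; map-++; map-cong; map-tabulate; take++drop≡id; take-map; length-take; length-drop; length-++; length-tabulate)
open import Data.List.Membership.Propositional using (_∈_; _∉_)
open import Data.List.Membership.Propositional.Properties using (∈-map⁻)
open import Data.List.Relation.Binary.Disjoint.Propositional using (Disjoint)
open import Data.List.Relation.Unary.All as All using (All; []; _∷_)
open import Data.List.Relation.Unary.All.Properties using (++⁻ʳ) renaming (take⁺ to All-take⁺)
open import Data.List.Relation.Unary.Any using (here; there)
open import Data.List.Relation.Unary.Unique.Propositional using (Unique; []; _∷_)
open import Data.List.Relation.Unary.Unique.Propositional.Properties
  using (allFin⁺; take⁺; drop⁺; map⁺; ++⁺; Unique[x∷xs]⇒x∉xs)
open import Data.Nat using (ℕ; zero; suc; _+_; _*_; _∸_; _≤_; _<_; _≤?_; _<ᵇ_; z≤n; s≤s)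
open import Data.Nat.Combinatorics using (_C_; nC1≡n; nCk+nC[k+1]≡[n+1]C[k+1])
open import Data.Nat.ListAction using () renaming (sum to listSum)
open import Data.Nat.ListAction.Properties using (sum-++)
open import Data.Nat.Properties hiding (_≟_; <-cmp)
open import Algebra.Properties.Semiring.Sum +-*-semiring
  using (sum-syntax; sum-cong-≗; ∑-distrib-+; *-distribˡ-sum; sum-replicate-zero)
open import Data.Nat.Tactic.RingSolver using (solve-∀)
open import Function using (id)
open import Data.Product using (∃; ∃₂; _×_; _,_; proj₁; proj₂)
open import Data.Sum using (inj₁; inj₂)
import Data.Vec as Vec
open import Data.Vec.Properties using (lookup∘tabulate; lookup⇒[]=)
open import Relation.Binary using (tri<; tri≈; tri>)
open import Relation.Binary.PropositionalEquality
open import Relation.Nullary using (¬_; does; yes; no; contradiction)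
open import Relation.Nullary.Decidable using (dec-true; dec-false; T?)

⟦_⟧ : Bool → ℕ
⟦ true ⟧ = 1
⟦ false ⟧ = 0

length-filterᵇ : ∀ {A : Set} (p : A → Bool) xs → length (filterᵇ p xs) ≡ listSum (map (λ x → ⟦ p x ⟧) xs)
length-filterᵇ p [] = refl
length-filterᵇ p (x ∷ xs) with p x
... | true  = cong suc (length-filterᵇ p xs)
... | false = length-filterᵇ p xs

sum-map-concatMap : ∀ {A B : Set} (f : B → ℕ) (g : A → List B) xs →
  listSum (map f (concatMap g xs)) ≡ listSum (map (λ x → listSum (map f (g x))) xs)
sum-map-concatMap f g [] = refl
sum-map-concatMap f g (x ∷ xs) = begin
  listSum (map f (g x ++ concatMap g xs))             ≡⟨ cong listSum (map-++ f (g x) _) ⟩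
  listSum (map f (g x) ++ map f (concatMap g xs))     ≡⟨ sum-++ (map f (g x)) _ ⟩
  listSum (map f (g x)) + listSum (map f (concatMap g xs)) ≡⟨ cong (_ +_) (sum-map-concatMap f g xs) ⟩
  _ ∎
  where open ≡-Reasoning

sum-tabulate : ∀ {n} (f : Fin n → ℕ) → listSum (tabulate f) ≡ ∑[ i < n ] f i
sum-tabulate {zero}  f = refl
sum-tabulate {suc n} f = cong (f zero +_) (sum-tabulate (λ i → f (suc i)))

sum-map-allFin : ∀ {n} (f : Fin n → ℕ) → listSum (map f (allFin n)) ≡ ∑[ i < n ] f i
sum-map-allFin f = trans (cong listSum (map-tabulate (λ i → i) f)) (sum-tabulate f)

∑-select : ∀ {n} (x : Fin n) (f : Fin n → ℕ) → ∑[ i < n ] (⟦ does (i ≟ x) ⟧ * f i) ≡ f x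
∑-select {suc n} zero f = trans (cong₂ _+_ (*-identityˡ (f zero)) (sum-replicate-zero n)) (+-identityʳ (f zero))
∑-select {suc n} (suc x) f = ∑-select x (λ i → f (suc i))

⟦⟧≤1 : ∀ b → ⟦ b ⟧ ≤ 1
⟦⟧≤1 true  = s≤s z≤n
⟦⟧≤1 false = z≤n

<ᵇ-true : ∀ {m n} → m < n → (m <ᵇ n) ≡ true
<ᵇ-true m<n = dec-true (T? _) (<⇒<ᵇ m<n)

<ᵇ-false : ∀ {m n} → ¬ m < n → (m <ᵇ n) ≡ false
<ᵇ-false m≮n = dec-false (T? _) (λ m<ᵇn → m≮n (<ᵇ⇒< _ _ m<ᵇn))

[1+n]C2≡n+nC2 : ∀ n → suc n C 2 ≡ n + n C 2
[1+n]C2≡n+nC2 n = begin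
  suc n C 2       ≡⟨ nCk+nC[k+1]≡[n+1]C[k+1] n 1 ⟨
  n C 1 + n C 2   ≡⟨ cong (_+ n C 2) (nC1≡n n) ⟩
  n + n C 2       ∎
  where open ≡-Reasoning

n∸1≤nC2 : ∀ n → n ∸ 1 ≤ n C 2
n∸1≤nC2 zero    = z≤n
n∸1≤nC2 (suc n) = subst (n ≤_) (sym ([1+n]C2≡n+nC2 n)) (m≤m+n n _)

[1+k]≡aC2+r : ∀ k → ∃₂ λ a r → suc k ≡ a C 2 + r × 1 ≤ r × r ≤ a
[1+k]≡aC2+r zero = 1 , 1 , refl , s≤s z≤n , s≤s z≤n
[1+k]≡aC2+r (suc k) with [1+k]≡aC2+r k
... | a , r , eq , 1≤r , r≤a with m≤n⇒m<n∨m≡n r≤a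
...   | inj₁ r<a  = a , suc r , trans (cong suc eq) (sym (+-suc (a C 2) r)) , s≤s z≤n , r<a
...   | inj₂ refl = suc a , 1 , (begin
  suc (suc k)       ≡⟨ cong suc eq ⟩
  suc (a C 2 + a)   ≡⟨ cong suc (+-comm (a C 2) a) ⟩
  suc (a + a C 2)   ≡⟨ +-comm 1 _ ⟩
  a + a C 2 + 1     ≡⟨ cong (_+ 1) ([1+n]C2≡n+nC2 a) ⟨
  suc a C 2 + 1     ∎) , s≤s z≤n , s≤s z≤n
  where open ≡-Reasoning

first-crossing : ∀ (h : ℕ → ℕ) {r} K → h 0 < r → r ≤ h K → ∃ λ t → t < K × h t < r × r ≤ h (suc t)
first-crossing h zero    h0<r r≤hK = contradiction (≤-trans h0<r r≤hK) (<-irrefl refl)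
first-crossing h {r} (suc K) h0<r r≤h[1+K] with r ≤? h K
... | yes r≤hK = let t , t<K , crossing = first-crossing h K h0<r r≤hK in t , m≤n⇒m≤1+n t<K , crossing
... | no  r≰hK = K , ≤-refl , ≰⇒> r≰hK , r≤h[1+K]

-- a, t, m describe the vertex set: the first t of the v's and a of the u's, exactly m of which
-- are matched to one of those v's.
record Decomposition (g : ℕ → ℕ) (k : ℕ) : Set where
  field
    a t m : ℕ
    m≤t   : m ≤ t
    m≤a   : m ≤ a
    fits  : a ∸ m + t ≤ k
    total : a C 2 + g t + m ≡ k

decompose : ∀ (g : ℕ → ℕ) → g 0 ≡ 0 → (∀ t → g (suc t) ≤ g t + t) → ∀ k → Decomposition g (suc k)
decompose g g0≡0 g-step k with [1+k]≡aC2+r k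
... | a , r , 1+k≡ , 1≤r , r≤a with first-crossing (λ t → g t + t) (suc k)
                                      (subst (λ x → x + 0 < r) (sym g0≡0) 1≤r)
                                      (≤-trans (subst (r ≤_) (sym 1+k≡) (m≤n+m r (a C 2))) (m≤n+m (suc k) _))
...   | s , _ , hs<r , r≤h[1+s] = record
  { a = a ; t = suc s ; m = r ∸ g (suc s)
  ; m≤t = subst (r ∸ g (suc s) ≤_) (m+n∸m≡n (g (suc s)) (suc s)) (∸-monoˡ-≤ (g (suc s)) r≤h[1+s])
  ; m≤a = ≤-trans (m∸n≤m r (g (suc s))) r≤a
  ; fits = ≤-trans (+-mono-≤ (≤-trans (∸-monoʳ-≤ a 1≤m) (n∸1≤nC2 a)) 1+s≤r) (≤-reflexive (sym 1+k≡))
  ; total = begin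
      a C 2 + g (suc s) + (r ∸ g (suc s))   ≡⟨ +-assoc (a C 2) _ _ ⟩
      a C 2 + (g (suc s) + (r ∸ g (suc s))) ≡⟨ cong (a C 2 +_) (m+[n∸m]≡n (<⇒≤ g[1+s]<r)) ⟩
      a C 2 + r                             ≡⟨ 1+k≡ ⟨
      suc k                                 ∎
  }
  where
  open ≡-Reasoning
  g[1+s]<r : g (suc s) < r
  g[1+s]<r = ≤-<-trans (g-step s) hs<r
  1≤m : 1 ≤ r ∸ g (suc s)
  1≤m = m<n⇒0<n∸m g[1+s]<r
  1+s≤r : suc s ≤ r
  1+s≤r = ≤-<-trans (m≤n+m s (g s)) hs<r

Unique-++⇒Disjoint : ∀ {A : Set} {xs ys : List A} → Unique (xs ++ ys) → Disjoint xs ys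
Unique-++⇒Disjoint {xs = x ∷ xs} (x∉ ∷ _)  (here refl , y∈ys)  = All.lookup (++⁻ʳ xs x∉) y∈ys refl
Unique-++⇒Disjoint {xs = x ∷ xs} (_ ∷ uniq) (there y∈xs , y∈ys) = Unique-++⇒Disjoint uniq (y∈xs , y∈ys)

drop∉take : ∀ {A : Set} {xs : List A} t → Unique xs → All (_∉ take t xs) (drop t xs)
drop∉take {xs = xs} t uniq = All.tabulate λ y∈drop y∈take →
  Unique-++⇒Disjoint (subst Unique (sym (take++drop≡id t xs)) uniq) (y∈take , y∈drop)

length-take-≤ : ∀ {A : Set} n (xs : List A) → n ≤ length xs → length (take n xs) ≡ n
length-take-≤ n xs n≤∣xs∣ = trans (length-take n xs) (m≤n⇒m⊓n≡m n≤∣xs∣)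

module _ {N : ℕ} (G : Graph N) where

  open import Data.List.Membership.DecPropositional (_≟_ {N}) using (_∈?_)

  edgeIndicator : (Fin N → Bool) → Fin N → Fin N → ℕ
  edgeIndicator s i j = ⟦ (i <ᵇF j) ∧ (s i ∧ (s j ∧ adj G i j)) ⟧

  edgesOf : (Fin N → Bool) → ℕ
  edgesOf s = ∑[ i < N ] ∑[ j < N ] edgeIndicator s i j

  degreeIn : (Fin N → Bool) → Fin N → ℕ
  degreeIn s x = ∑[ j < N ] ⟦ s j ∧ adj G x j ⟧

  insert : Fin N → (Fin N → Bool) → Fin N → Bool
  insert x s y = does (y ≟ x) ∨ s y

  inducedEdges-tabulate : ∀ s → inducedEdges G (Vec.tabulate s) ≡ edgesOf s
  inducedEdges-tabulate s = begin
    inducedEdges G S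
      ≡⟨ length-filterᵇ P (allPairs N) ⟩
    listSum (map (λ q → ⟦ P q ⟧) (allPairs N))
      ≡⟨ sum-map-concatMap (λ q → ⟦ P q ⟧) row (allFin N) ⟩
    listSum (map (λ i → listSum (map (λ q → ⟦ P q ⟧) (row i))) (allFin N))
      ≡⟨ cong listSum (map-cong rowSum (allFin N)) ⟩
    listSum (map (λ i → ∑[ j < N ] edgeIndicator s i j) (allFin N))
      ≡⟨ sum-map-allFin {N} _ ⟩
    edgesOf s ∎
    where
    open ≡-Reasoning
    S = Vec.tabulate s
    P : Fin N × Fin N → Bool
    P (i , j) = (i <ᵇF j) ∧ (Vec.lookup S i ∧ (Vec.lookup S j ∧ adj G i j))
    row : Fin N → List (Fin N × Fin N)
    row i = map (i ,_) (allFin N)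
    entry : ∀ i j → ⟦ P (i , j) ⟧ ≡ edgeIndicator s i j
    entry i j rewrite lookup∘tabulate s i | lookup∘tabulate s j = refl
    rowSum : ∀ i → listSum (map (λ q → ⟦ P q ⟧) (row i)) ≡ ∑[ j < N ] edgeIndicator s i j
    rowSum i = begin
      listSum (map (λ q → ⟦ P q ⟧) (row i))      ≡⟨ cong listSum (sym (map-∘ (allFin N))) ⟩
      listSum (map (λ j → ⟦ P (i , j) ⟧) (allFin N)) ≡⟨ cong listSum (map-cong (entry i) (allFin N)) ⟩
      listSum (map (edgeIndicator s i) (allFin N))  ≡⟨ sum-map-allFin {N} _ ⟩
      ∑[ j < N ] edgeIndicator s i j ∎

  private
    ∑₂ : (Fin N → Fin N → ℕ) → ℕ
    ∑₂ f = ∑[ i < N ] ∑[ j < N ] f i j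

    ∑₂-distrib-+ : ∀ f g → ∑₂ (λ i j → f i j + g i j) ≡ ∑₂ f + ∑₂ g
    ∑₂-distrib-+ f g = trans (sum-cong-≗ {N} (λ i → ∑-distrib-+ (f i) (g i))) (∑-distrib-+ {N} _ _)

  edgeIndicator-insert : ∀ s x → s x ≡ false → ∀ i j →
    edgeIndicator (insert x s) i j
      ≡ edgeIndicator s i j + (⟦ does (i ≟ x) ⟧ * ⟦ (i <ᵇF j) ∧ (s j ∧ adj G i j) ⟧
                              + ⟦ does (j ≟ x) ⟧ * ⟦ (i <ᵇF j) ∧ (s i ∧ adj G i j) ⟧)
  edgeIndicator-insert s x sx i j with i ≟ x | j ≟ x
  ... | no _     | no _     = sym (+-identityʳ _)
  ... | yes refl | yes refl rewrite <ᵇ-false (n≮n (toℕ i)) = refl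
  ... | yes refl | no _     rewrite sx with i <ᵇF j
  ...   | false = refl
  ...   | true  = sym (trans (+-identityʳ _) (+-identityʳ _))
  edgeIndicator-insert s x sx i j | no _ | yes refl rewrite sx with i <ᵇF j | s i
  ...   | false | _     = refl
  ...   | true  | false = refl
  ...   | true  | true  = sym (+-identityʳ _)

  edgeIndicator-around : ∀ (s : Fin N → Bool) x → s x ≡ false → ∀ j →
    ⟦ (x <ᵇF j) ∧ (s j ∧ adj G x j) ⟧ + ⟦ (j <ᵇF x) ∧ (s j ∧ adj G j x) ⟧ ≡ ⟦ s j ∧ adj G x j ⟧
  edgeIndicator-around s x sx j with <-cmp x j
  ... | tri< x<j _ x≯j rewrite <ᵇ-true x<j | <ᵇ-false x≯j = +-identityʳ _
  ... | tri> x≮j _ x>j rewrite <ᵇ-false x≮j | <ᵇ-true x>j | adj-sym G j x = refl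
  ... | tri≈ x≮j refl _ rewrite <ᵇ-false x≮j | sx = refl

  edgesOf-insert : ∀ s x → s x ≡ false → edgesOf (insert x s) ≡ edgesOf s + degreeIn s x
  edgesOf-insert s x sx = begin
    edgesOf (insert x s)
      ≡⟨ sum-cong-≗ {N} (λ i → sum-cong-≗ {N} (edgeIndicator-insert s x sx i)) ⟩
    ∑₂ (λ i j → edgeIndicator s i j + (δ i * out i j + δ j * into i j))
      ≡⟨ ∑₂-distrib-+ (edgeIndicator s) _ ⟩
    edgesOf s + ∑₂ (λ i j → δ i * out i j + δ j * into i j)
      ≡⟨ cong (edgesOf s +_) (∑₂-distrib-+ _ _) ⟩
    edgesOf s + (∑₂ (λ i j → δ i * out i j) + ∑₂ (λ i j → δ j * into i j))
      ≡⟨ cong (edgesOf s +_) (cong₂ _+_ selectRow selectColumn) ⟩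
    edgesOf s + (∑[ j < N ] out x j + ∑[ j < N ] into j x)
      ≡⟨ cong (edgesOf s +_) (sym (∑-distrib-+ {N} _ _)) ⟩
    edgesOf s + ∑[ j < N ] (out x j + into j x)
      ≡⟨ cong (edgesOf s +_) (sum-cong-≗ {N} (edgeIndicator-around s x sx)) ⟩
    edgesOf s + degreeIn s x ∎
    where
    open ≡-Reasoning
    δ : Fin N → ℕ
    δ i = ⟦ does (i ≟ x) ⟧
    out into : Fin N → Fin N → ℕ
    out i j = ⟦ (i <ᵇF j) ∧ (s j ∧ adj G i j) ⟧
    into i j = ⟦ (i <ᵇF j) ∧ (s i ∧ adj G i j) ⟧
    selectRow : ∑₂ (λ i j → δ i * out i j) ≡ ∑[ j < N ] out x j
    selectRow = trans (sum-cong-≗ {N} (λ i → sym (*-distribˡ-sum (δ i) (out i)))) (∑-select x _)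
    selectColumn : ∑₂ (λ i j → δ j * into i j) ≡ ∑[ i < N ] into i x
    selectColumn = sum-cong-≗ {N} (λ i → ∑-select x (into i))

  edgesOf-empty : edgesOf (λ _ → false) ≡ 0
  edgesOf-empty = begin
    edgesOf (λ _ → false)   ≡⟨ sum-cong-≗ {N} (λ i → sum-cong-≗ {N} (noEdge i)) ⟩
    ∑₂ (λ _ _ → 0)          ≡⟨ sum-cong-≗ {N} (λ _ → sum-replicate-zero N) ⟩
    ∑[ i < N ] 0            ≡⟨ sum-replicate-zero N ⟩
    0                       ∎
    where
    open ≡-Reasoning
    noEdge : ∀ i j → edgeIndicator (λ _ → false) i j ≡ 0
    noEdge i j with i <ᵇF j
    ... | true  = refl
    ... | false = refl

  degreeIn-insert : ∀ s y x → s y ≡ false → degreeIn (insert y s) x ≡ ⟦ adj G x y ⟧ + degreeIn s x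
  degreeIn-insert s y x sy = begin
    ∑[ j < N ] ⟦ (does (j ≟ y) ∨ s j) ∧ adj G x j ⟧
      ≡⟨ sum-cong-≗ {N} split ⟩
    ∑[ j < N ] (⟦ does (j ≟ y) ⟧ * ⟦ adj G x j ⟧ + ⟦ s j ∧ adj G x j ⟧)
      ≡⟨ ∑-distrib-+ {N} _ _ ⟩
    ∑[ j < N ] (⟦ does (j ≟ y) ⟧ * ⟦ adj G x j ⟧) + degreeIn s x
      ≡⟨ cong (_+ degreeIn s x) (∑-select y _) ⟩
    ⟦ adj G x y ⟧ + degreeIn s x ∎
    where
    open ≡-Reasoning
    split : ∀ j → ⟦ (does (j ≟ y) ∨ s j) ∧ adj G x j ⟧
                ≡ ⟦ does (j ≟ y) ⟧ * ⟦ adj G x j ⟧ + ⟦ s j ∧ adj G x j ⟧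
    split j with j ≟ y
    ... | no _     = refl
    ... | yes refl rewrite sy = sym (trans (+-identityʳ _) (+-identityʳ _))

  neighboursIn : Fin N → List (Fin N) → ℕ
  neighboursIn x ys = listSum (map (λ y → ⟦ adj G x y ⟧) ys)

  edgesIn : List (Fin N) → ℕ
  edgesIn []       = 0
  edgesIn (x ∷ xs) = neighboursIn x xs + edgesIn xs

  membership : List (Fin N) → Fin N → Bool
  membership xs y = does (y ∈? xs)

  degreeIn-membership : ∀ x {ys} → Unique ys → degreeIn (membership ys) x ≡ neighboursIn x ys
  degreeIn-membership x {[]}     []               = sum-replicate-zero N
  degreeIn-membership x {y ∷ ys} uniq@(_ ∷ uniq-ys) =
    trans (degreeIn-insert (membership ys) y x (dec-false (y ∈? ys) (Unique[x∷xs]⇒x∉xs uniq)))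
          (cong (⟦ adj G x y ⟧ +_) (degreeIn-membership x uniq-ys))

  edgesOf-membership : ∀ {xs} → Unique xs → edgesOf (membership xs) ≡ edgesIn xs
  edgesOf-membership {[]} [] = edgesOf-empty
  edgesOf-membership {x ∷ xs} uniq@(_ ∷ uniq-xs) = begin
    edgesOf (insert x (membership xs))
      ≡⟨ edgesOf-insert (membership xs) x (dec-false (x ∈? xs) (Unique[x∷xs]⇒x∉xs uniq)) ⟩
    edgesOf (membership xs) + degreeIn (membership xs) x
      ≡⟨ cong₂ _+_ (edgesOf-membership uniq-xs) (degreeIn-membership x uniq-xs) ⟩
    edgesIn xs + neighboursIn x xs
      ≡⟨ +-comm (edgesIn xs) _ ⟩
    edgesIn (x ∷ xs) ∎
    where open ≡-Reasoning

  hasInducedSubgraph-edgesIn : ∀ x xs → Unique (x ∷ xs) → HasKEdgeInducedSubgraph G (edgesIn (x ∷ xs))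
  hasInducedSubgraph-edgesIn x xs uniq = S , (x , x∈S) , trans (inducedEdges-tabulate _) (edgesOf-membership uniq)
    where
    S = Vec.tabulate (membership (x ∷ xs))
    x∈S : x Subset.∈ S
    x∈S = lookup⇒[]= x S (trans (lookup∘tabulate _ x) (cong (_∨ membership xs x) (dec-true (x ≟ x) refl)))

  crossEdges : List (Fin N) → List (Fin N) → ℕ
  crossEdges xs ys = listSum (map (λ x → neighboursIn x ys) xs)

  neighboursIn-++ : ∀ x ys zs → neighboursIn x (ys ++ zs) ≡ neighboursIn x ys + neighboursIn x zs
  neighboursIn-++ x ys zs = trans (cong listSum (map-++ _ ys zs)) (sum-++ (map _ ys) _)

  edgesIn-++ : ∀ xs ys → edgesIn (xs ++ ys) ≡ edgesIn xs + edgesIn ys + crossEdges xs ys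
  edgesIn-++ []       ys = sym (+-identityʳ _)
  edgesIn-++ (x ∷ xs) ys = begin
    neighboursIn x (xs ++ ys) + edgesIn (xs ++ ys)
      ≡⟨ cong₂ _+_ (neighboursIn-++ x xs ys) (edgesIn-++ xs ys) ⟩
    neighboursIn x xs + neighboursIn x ys + (edgesIn xs + edgesIn ys + crossEdges xs ys)
      ≡⟨ regroup (neighboursIn x xs) _ _ _ _ ⟩
    edgesIn (x ∷ xs) + edgesIn ys + crossEdges (x ∷ xs) ys ∎
    where
    open ≡-Reasoning
    regroup : ∀ a b c d e → a + b + (c + d + e) ≡ a + c + d + (b + e)
    regroup = solve-∀

  neighboursIn-take-suc : ∀ x t ys → neighboursIn x (take (suc t) ys) ≤ neighboursIn x (take t ys) + 1
  neighboursIn-take-suc x zero    []       = z≤n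
  neighboursIn-take-suc x zero    (y ∷ ys) = ≤-trans (≤-reflexive (+-identityʳ _)) (⟦⟧≤1 (adj G x y))
  neighboursIn-take-suc x (suc t) []       = z≤n
  neighboursIn-take-suc x (suc t) (y ∷ ys) =
    ≤-trans (+-monoʳ-≤ ⟦ adj G x y ⟧ (neighboursIn-take-suc x t ys)) (≤-reflexive (sym (+-assoc ⟦ adj G x y ⟧ _ 1)))

  edgesIn-take-suc : ∀ t xs → edgesIn (take (suc t) xs) ≤ edgesIn (take t xs) + t
  edgesIn-take-suc zero    []       = z≤n
  edgesIn-take-suc zero    (x ∷ xs) = z≤n
  edgesIn-take-suc (suc t) []       = z≤n
  edgesIn-take-suc (suc t) (x ∷ xs) = ≤-trans
    (+-mono-≤ (neighboursIn-take-suc x t xs) (edgesIn-take-suc t xs))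
    (≤-reflexive (regroup (neighboursIn x (take t xs)) (edgesIn (take t xs)) t))
    where
    regroup : ∀ a b c → a + 1 + (b + c) ≡ a + b + suc c
    regroup = solve-∀

module _ {N k} {G : Graph N} (cm : CliqueMatching G k) where
  open CliqueMatching cm

  neighboursIn-clique : ∀ i {J} → All (i ≢_) J → neighboursIn G (u i) (map u J) ≡ length J
  neighboursIn-clique i []          = refl
  neighboursIn-clique i (i≢j ∷ i≢J) rewrite cm2 _ _ i≢j = cong suc (neighboursIn-clique i i≢J)

  edgesIn-clique : ∀ {J} → Unique J → edgesIn G (map u J) ≡ length J C 2
  edgesIn-clique []              = refl
  edgesIn-clique {j ∷ J} (j∉J ∷ uniq) = trans (cong₂ _+_ (neighboursIn-clique j j∉J) (edgesIn-clique uniq))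
                                              (sym ([1+n]C2≡n+nC2 (length J)))

  neighboursIn-unmatched : ∀ {i T} → i ∉ T → neighboursIn G (u i) (map v T) ≡ 0
  neighboursIn-unmatched {T = []}    i∉T = refl
  neighboursIn-unmatched {i} {j ∷ T} i∉T
    rewrite ¬-not (λ uᵢ~vⱼ → i∉T (here (proj₁ (cm1 i j) uᵢ~vⱼ))) = neighboursIn-unmatched (λ i∈T → i∉T (there i∈T))

  neighboursIn-matched : ∀ {i T} → Unique T → i ∈ T → neighboursIn G (u i) (map v T) ≡ 1
  neighboursIn-matched {i} (i∉T ∷ _) (here refl) rewrite proj₂ (cm1 i i) refl =
    cong suc (neighboursIn-unmatched (λ i∈T → All.lookup i∉T i∈T refl))
  neighboursIn-matched {i} {j ∷ T} (j∉T ∷ uniq) (there i∈T)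
    rewrite ¬-not (λ uᵢ~vⱼ → All.lookup j∉T i∈T (sym (proj₁ (cm1 i j) uᵢ~vⱼ))) = neighboursIn-matched uniq i∈T

  crossEdges-unmatched : ∀ {A T} → All (_∉ T) A → crossEdges G (map u A) (map v T) ≡ 0
  crossEdges-unmatched []            = refl
  crossEdges-unmatched (i∉T ∷ A∉T) = cong₂ _+_ (neighboursIn-unmatched i∉T) (crossEdges-unmatched A∉T)

  crossEdges-matching : ∀ {T A₁ A₂} → Unique T → All (_∈ T) A₁ → All (_∉ T) A₂ →
                        crossEdges G (map u (A₁ ++ A₂)) (map v T) ≡ length A₁
  crossEdges-matching uniq-T []            A₂∉T = crossEdges-unmatched A₂∉T
  crossEdges-matching uniq-T (i∈T ∷ A₁⊆T) A₂∉T =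
    cong₂ _+_ (neighboursIn-matched uniq-T i∈T) (crossEdges-matching uniq-T A₁⊆T A₂∉T)

  prefix : ℕ → List (Fin k)
  prefix t = take t (allFin k)

  prefixEdges : ℕ → ℕ
  prefixEdges t = edgesIn G (map v (prefix t))

  prefixEdges-suc : ∀ t → prefixEdges (suc t) ≤ prefixEdges t + t
  prefixEdges-suc t = subst₂ (λ xs ys → edgesIn G xs ≤ edgesIn G ys + t)
    (take-map (suc t) (allFin k)) (take-map t (allFin k)) (edgesIn-take-suc G t (map v (allFin k)))

  length-prefix : ∀ {t} → t ≤ k → length (prefix t) ≡ t
  length-prefix t≤k = length-take-≤ _ (allFin k) (subst (_ ≤_) (sym (length-tabulate id)) t≤k)

  matched : (t m : ℕ) → List (Fin k)
  matched t m = take m (prefix t)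

  unmatched : (t p : ℕ) → List (Fin k)
  unmatched t p = take p (drop t (allFin k))

  cliqueIndices : (a t m : ℕ) → List (Fin k)
  cliqueIndices a t m = matched t m ++ unmatched t (a ∸ m)

  vertices : (a t m : ℕ) → List (Fin N)
  vertices a t m = map u (cliqueIndices a t m) ++ map v (prefix t)

  prefix-unique : ∀ t → Unique (prefix t)
  prefix-unique t = take⁺ t (allFin⁺ k)

  matched⊆prefix : ∀ t m → All (_∈ prefix t) (matched t m)
  matched⊆prefix t m = All-take⁺ m (All.tabulate id)

  unmatched∉prefix : ∀ t p → All (_∉ prefix t) (unmatched t p)
  unmatched∉prefix t p = All-take⁺ p (drop∉take t (allFin⁺ k))

  cliqueIndices-unique : ∀ a t m → Unique (cliqueIndices a t m)
  cliqueIndices-unique a t m = ++⁺ (take⁺ m (prefix-unique t)) (take⁺ (a ∸ m) (drop⁺ t (allFin⁺ k)))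
    (λ (i∈matched , i∈unmatched) →
      All.lookup (unmatched∉prefix t (a ∸ m)) i∈unmatched (All.lookup (matched⊆prefix t m) i∈matched))

  vertices-unique : ∀ a t m → Unique (vertices a t m)
  vertices-unique a t m = ++⁺ (map⁺ (u-inj _ _) (cliqueIndices-unique a t m)) (map⁺ (v-inj _ _) (prefix-unique t)) u#v
    where
    u#v : Disjoint (map u (cliqueIndices a t m)) (map v (prefix t))
    u#v (x∈uA , x∈vT) with ∈-map⁻ u x∈uA | ∈-map⁻ v x∈vT
    ... | i , _ , refl | j , _ , uᵢ≡vⱼ = uv-dis i j uᵢ≡vⱼ

  length-matched : ∀ {t m} → m ≤ t → t ≤ k → length (matched t m) ≡ m
  length-matched {t} {m} m≤t t≤k = length-take-≤ m (prefix t) (subst (m ≤_) (sym (length-prefix t≤k)) m≤t)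

  length-unmatched : ∀ {t p} → p + t ≤ k → length (unmatched t p) ≡ p
  length-unmatched {t} {p} p+t≤k = length-take-≤ p (drop t (allFin k))
    (subst (p ≤_) (sym (trans (length-drop t (allFin k)) (cong (_∸ t) (length-tabulate id)))) (m+n≤o⇒m≤o∸n p p+t≤k))

  length-cliqueIndices : ∀ {a t m} → m ≤ t → m ≤ a → a ∸ m + t ≤ k → length (cliqueIndices a t m) ≡ a
  length-cliqueIndices {a} {t} {m} m≤t m≤a fits = begin
    length (matched t m ++ unmatched t (a ∸ m))         ≡⟨ length-++ (matched t m) ⟩
    length (matched t m) + length (unmatched t (a ∸ m)) ≡⟨ cong₂ _+_ (length-matched m≤t (m+n≤o⇒n≤o (a ∸ m) fits))
                                                                     (length-unmatched fits) ⟩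
    m + (a ∸ m)                                         ≡⟨ m+[n∸m]≡n m≤a ⟩
    a                                                   ∎
    where open ≡-Reasoning

  edgesIn-vertices : ∀ {a t m} → m ≤ t → m ≤ a → a ∸ m + t ≤ k →
                     edgesIn G (vertices a t m) ≡ a C 2 + prefixEdges t + m
  edgesIn-vertices {a} {t} {m} m≤t m≤a fits = begin
    edgesIn G (map u A ++ map v (prefix t))
      ≡⟨ edgesIn-++ G (map u A) (map v (prefix t)) ⟩
    edgesIn G (map u A) + prefixEdges t + crossEdges G (map u A) (map v (prefix t))
      ≡⟨ cong₂ (λ x y → x + prefixEdges t + y) clique matching ⟩
    a C 2 + prefixEdges t + m ∎
    where
    open ≡-Reasoning
    A = cliqueIndices a t m
    clique : edgesIn G (map u A) ≡ a C 2
    clique = trans (edgesIn-clique (cliqueIndices-unique a t m)) (cong (_C 2) (length-cliqueIndices m≤t m≤a fits))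
    matching : crossEdges G (map u A) (map v (prefix t)) ≡ m
    matching = trans (crossEdges-matching (prefix-unique t) (matched⊆prefix t m) (unmatched∉prefix t (a ∸ m)))
                     (length-matched m≤t (m+n≤o⇒n≤o (a ∸ m) fits))

  vertexList : Decomposition prefixEdges k → ∃ λ L → Unique L × edgesIn G L ≡ k
  vertexList d = vertices a t m , vertices-unique a t m , trans (edgesIn-vertices m≤t m≤a fits) total
    where open Decomposition d

lemma3p4 : (k n : ℕ) (G : Graph (suc n)) → CliqueMatching G k → HasKEdgeInducedSubgraph G k
lemma3p4 zero    n G cm = hasInducedSubgraph-edgesIn G zero [] ([] ∷ [])
lemma3p4 (suc k) n G cm with vertexList cm (decompose (prefixEdges cm) refl (prefixEdges-suc cm) k)
... | x ∷ L , uniq , count = subst (HasKEdgeInducedSubgraph G) count (hasInducedSubgraph-edgesIn G x L uniq)
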